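{- Let $\mathbf S$ be a species and $p_n(\mathbf y)$ the linear sequence of symmetric functions of binomial type associated with $\mathbf S$. Then for every complex number $a$ and every $n\ge0$, $$p_n(a,y_1,y_2,\dots)=\sum_{k=0}^n\binom nk\,p_k(a,0,0,\dots)\,p_{n-k}(y_1,y_2,\dots).$$
   Context: A species $\mathbf S$ is a functor from finite sets with bijections to finite sets with bijections, with $|\mathbf S[\emptyset]|=1$ and $|\mathbf S[E]|\ge1$ for $|E|=1$. An $\mathbf S$-enriched function from $N$ to $X$ is a pair $(f,(A_x)_{x\in X})$ with $f:N\to X$, $A_x\in\mathbf S[f^{ -1}(x)]$. The associated linear sequence of binomial type is $p_n(\mathbf y)=\sum\prod_{i=1}^n y_{f(i)}$ over all $\mathbf S$-enriched functions from $\{1,\dots,n\}$ to $\{1,2,\dots\}$; it is a symmetric function in $\mathbf y=(y_1,y_2,\dots)$, and $p_n(a,y_1,y_2,\dots)$ denotes substitution of the variable list $(a,y_1,y_2,\dots)$. -}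

module Defs where

open import Level using (Level)
open import Data.Nat as ℕ using (ℕ; zero; suc; _≤_; _∸_)
open import Data.Nat.Combinatorics using (_C_)
open import Data.Fin as Fin using (Fin; toℕ)
open import Data.Fin.Properties using () renaming (_≟_ to _≟ᶠ_)
open import Data.List using (List; []; _∷_; map; concatMap; upTo; foldr; allFin)
open import Data.Vec.Functional using (Vector) renaming (_∷_ to _∷ᵛ_)
open import Relation.Nullary using (yes; no)
open import Relation.Binary.PropositionalEquality using (_≡_)
open import Function.Bundles using (_↔_; Inverse)
open import Function.Construct.Identity using (↔-id)
open import Function.Construct.Composition using (_↔-∘_)
open import Algebra.Bundles using (CommutativeRing)

-- The category of finite sets with bijections is equivalent to its
-- skeleton {Fin k}, so a species is given by: a set S[k] of structures
-- on the k-element set Fin k (finite, of cardinality `card k`),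
-- together with a functorial action of the bijections Fin k ↔ Fin k.
-- For an arbitrary finite set E with |E| = k, S[E] is S[k] (transported
-- along any labelling E ↔ Fin k).

record Species : Set₁ where
  field
    Str      : ℕ → Set
    card     : ℕ → ℕ
    finite   : ∀ k → Str k ↔ Fin (card k)
    relabel  : ∀ {k} → (Fin k ↔ Fin k) → Str k → Str k
    relabel-id : ∀ {k} (s : Str k) → relabel (↔-id (Fin k)) s ≡ s
    relabel-∘  : ∀ {k} (σ τ : Fin k ↔ Fin k) (s : Str k) →
                 relabel (σ ↔-∘ τ) s ≡ relabel σ (relabel τ s)
    card-0   : card 0 ≡ 1
    card-1   : 1 ≤ card 1

allFuns : (n m : ℕ) → List (Fin n → Fin m)
allFuns zero    m = (λ ()) ∷ []
allFuns (suc n) m =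
  concatMap (λ x → map (λ f → x ∷ᵛ f) (allFuns n m)) (allFin m)

fibreSize : ∀ {n m} → (Fin n → Fin m) → Fin m → ℕ
fibreSize {zero}  f x = 0
fibreSize {suc n} f x with f Fin.zero ≟ᶠ x
... | yes _ = suc (fibreSize (λ i → f (Fin.suc i)) x)
... | no  _ = fibreSize (λ i → f (Fin.suc i)) x

-- The linear sequence of binomial type p_n, evaluated in a commutative
-- ring at the variable list (y₁,…,y_m,0,0,…).
--   p_n(y) = Σ_{S-enriched f : [n] → [m]} ∏_{i} y_{f(i)}
--          = Σ_{f : Fin n → Fin m} (∏_{x} |S[f⁻¹(x)]|) · ∏_{i} y_{f(i)}
-- (the number of S-enrichments of f is ∏_x |S[f⁻¹(x)]|; functions
-- with values outside {1..m} contribute 0 since those variables are 0).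

module _ {c ℓ : Level} (R : CommutativeRing c ℓ) where
  open CommutativeRing R

  ℕ→R : ℕ → Carrier
  ℕ→R zero    = 0#
  ℕ→R (suc k) = 1# + ℕ→R k

  ΣL : ∀ {A : Set} → List A → (A → Carrier) → Carrier
  ΣL xs g = foldr (λ a r → g a + r) 0# xs

  ΠF : ∀ k → (Fin k → Carrier) → Carrier
  ΠF zero    g = 1#
  ΠF (suc k) g = g Fin.zero * ΠF k (λ i → g (Fin.suc i))

  p : Species → (n : ℕ) → ∀ {m} → Vector Carrier m → Carrier
  p S n {m} y = ΣL (allFuns n m) λ f →
      ΠF m (λ x → ℕ→R (Species.card S (fibreSize f x)))
    * ΠF n (λ i → y (f i))

{-# OPTIONS --safe #-}
module Submission where

-- Peeling off the first point of [n+1], which goes either to the variable a or to some y_x, adds one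
-- point to the fibre over its image. Recording such extra points by an offset vector e, this gives
-- p^e_{n+1}(y) = Σ_x y_x p^{e+δ_x}_n(y), and then by induction on n
-- p^e_n(a,y) = B_n(k ↦ p^{e₀}_k(a), j ↦ p^{e′}_j(y)) for the convolution B defined by Pascal's recursion
-- B_{n+1}(F,G) = B_n(F ∘ suc, G) + B_n(F, G ∘ suc). Pascal's rule for binomial coefficients shows that
-- B_n(F,G) = Σ_k C(n,k) F_k G_{n-k}.

open import Defs
open import Level using (Level)
open import Data.Nat using (ℕ; _∸_)
import Data.Nat as ℕ
open import Data.Nat.Combinatorics using (_C_; k>n⇒nCk≡0; nCk+nC[k+1]≡[n+1]C[k+1])
import Data.Nat.Properties as ℕₚ
open import Data.Fin using (Fin; zero; suc; toℕ; inject₁; fromℕ; _≟_)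
open import Data.Fin.Properties using (toℕ-inject₁; toℕ-fromℕ)
open import Data.List as List using (List; _++_; map; concatMap; applyUpTo; upTo; tabulate; allFin)
open import Data.Vec.Functional using (Vector; []; _∷_; head; tail; updateAt)
open import Data.Vec.Functional.Properties using (updateAt-updates; updateAt-minimal)
open import Function using (_∘_)
open import Relation.Nullary using (yes; no)
open import Relation.Binary.PropositionalEquality as ≡ using (_≡_; _≗_)
open import Algebra.Bundles using (CommutativeRing)
import Algebra.Properties.CommutativeSemigroup as CommutativeSemigroupProperties
import Algebra.Properties.Semiring.Sum as SemiringSum

+-fibreSize-∷ : ∀ {n m} (e : Vector ℕ m) x (f : Fin n → Fin m) z →
                e z ℕ.+ fibreSize (x ∷ f) z ≡ updateAt e x ℕ.suc z ℕ.+ fibreSize f z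
+-fibreSize-∷ e x f z with x ≟ z
... | yes ≡.refl = ≡.trans (ℕₚ.+-suc (e x) _) (≡.cong (ℕ._+ _) (≡.sym (updateAt-updates x e)))
... | no x≢z = ≡.cong (ℕ._+ _) (≡.sym (updateAt-minimal z x e (x≢z ∘ ≡.sym)))

∸-toℕ-suc : ∀ {n} (j : Fin n) → n ∸ toℕ j ≡ ℕ.suc (n ∸ ℕ.suc (toℕ j))
∸-toℕ-suc {ℕ.suc n} zero    = ≡.refl
∸-toℕ-suc {ℕ.suc n} (suc j) = ∸-toℕ-suc j

module _ {c ℓ : Level} (R : CommutativeRing c ℓ) where
  open CommutativeRing R hiding (zero)
  open SemiringSum semiring
    using (sum-syntax; sum⁺-syntax; sum-cong-≋; ∑-distrib-+; *-distribˡ-sum; sum-init-last)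
  open CommutativeSemigroupProperties *-commutativeSemigroup using (x∙yz≈y∙xz)
  open CommutativeSemigroupProperties +-commutativeSemigroup using () renaming (x∙yz≈y∙xz to x+yz≈y+xz)
  open import Relation.Binary.Reasoning.Setoid setoid

  ℕ→R-homo-+ : ∀ i j → ℕ→R R (i ℕ.+ j) ≈ ℕ→R R i + ℕ→R R j
  ℕ→R-homo-+ ℕ.zero    j = sym (+-identityˡ _)
  ℕ→R-homo-+ (ℕ.suc i) j = trans (+-congˡ (ℕ→R-homo-+ i j)) (sym (+-assoc _ _ _))

  ΠF-cong : ∀ k {g h : Fin k → Carrier} → (∀ i → g i ≈ h i) → ΠF R k g ≈ ΠF R k h
  ΠF-cong ℕ.zero    g≈h = refl
  ΠF-cong (ℕ.suc k) g≈h = *-cong (g≈h zero) (ΠF-cong k (g≈h ∘ suc))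

  ΣL-cong : ∀ {A : Set} (xs : List A) {g h : A → Carrier} → (∀ x → g x ≈ h x) →
            ΣL R xs g ≈ ΣL R xs h
  ΣL-cong List.[]       g≈h = refl
  ΣL-cong (x List.∷ xs) g≈h = +-cong (g≈h x) (ΣL-cong xs g≈h)

  ΣL-++ : ∀ {A : Set} (xs ys : List A) g → ΣL R (xs ++ ys) g ≈ ΣL R xs g + ΣL R ys g
  ΣL-++ List.[]       ys g = sym (+-identityˡ _)
  ΣL-++ (x List.∷ xs) ys g = trans (+-congˡ (ΣL-++ xs ys g)) (sym (+-assoc _ _ _))

  ΣL-concatMap : ∀ {A B : Set} (h : A → List B) (xs : List A) g →
                 ΣL R (concatMap h xs) g ≈ ΣL R xs (λ x → ΣL R (h x) g)
  ΣL-concatMap h List.[]       g = refl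
  ΣL-concatMap h (x List.∷ xs) g = trans (ΣL-++ (h x) (concatMap h xs) g) (+-congˡ (ΣL-concatMap h xs g))

  ΣL-map : ∀ {A B : Set} (h : A → B) (xs : List A) g → ΣL R (map h xs) g ≈ ΣL R xs (g ∘ h)
  ΣL-map h List.[]       g = refl
  ΣL-map h (x List.∷ xs) g = +-congˡ (ΣL-map h xs g)

  *-distribˡ-ΣL : ∀ {A : Set} a (xs : List A) g → a * ΣL R xs g ≈ ΣL R xs (λ x → a * g x)
  *-distribˡ-ΣL a List.[]       g = zeroʳ a
  *-distribˡ-ΣL a (x List.∷ xs) g = trans (distribˡ a _ _) (+-congˡ (*-distribˡ-ΣL a xs g))

  ΣL-tabulate : ∀ {A : Set} k (f : Fin k → A) g → ΣL R (tabulate f) g ≈ ∑[ i < k ] g (f i)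
  ΣL-tabulate ℕ.zero    f g = refl
  ΣL-tabulate (ℕ.suc k) f g = +-congˡ (ΣL-tabulate k (f ∘ suc) g)

  ΣL-applyUpTo : ∀ (f : ℕ → ℕ) k g → ΣL R (applyUpTo f k) g ≈ ∑[ i < k ] g (f (toℕ i))
  ΣL-applyUpTo f ℕ.zero    g = refl
  ΣL-applyUpTo f (ℕ.suc k) g = +-congˡ (ΣL-applyUpTo (f ∘ ℕ.suc) k g)

  pascalConvolution : ℕ → (ℕ → Carrier) → (ℕ → Carrier) → Carrier
  pascalConvolution ℕ.zero    F G = F 0 * G 0
  pascalConvolution (ℕ.suc n) F G = pascalConvolution n (F ∘ ℕ.suc) G + pascalConvolution n F (G ∘ ℕ.suc)

  pascalConvolution-cong : ∀ n {F F′ G G′ : ℕ → Carrier} →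
                           (∀ k → F k ≈ F′ k) → (∀ k → G k ≈ G′ k) →
                           pascalConvolution n F G ≈ pascalConvolution n F′ G′
  pascalConvolution-cong ℕ.zero    F≈F′ G≈G′ = *-cong (F≈F′ 0) (G≈G′ 0)
  pascalConvolution-cong (ℕ.suc n) F≈F′ G≈G′ =
    +-cong (pascalConvolution-cong n (F≈F′ ∘ ℕ.suc) G≈G′)
           (pascalConvolution-cong n F≈F′ (G≈G′ ∘ ℕ.suc))

  *-distribˡ-pascalConvolution : ∀ n a F G →
                                 a * pascalConvolution n F G ≈ pascalConvolution n (λ k → a * F k) G
  *-distribˡ-pascalConvolution ℕ.zero    a F G = sym (*-assoc _ _ _)
  *-distribˡ-pascalConvolution (ℕ.suc n) a F G =
    trans (distribˡ a _ _)
          (+-cong (*-distribˡ-pascalConvolution n a _ G) (*-distribˡ-pascalConvolution n a F _))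

  ∑-pascalConvolutionʳ : ∀ n {m} (w : Vector Carrier m) F (H : Fin m → ℕ → Carrier) →
                         ∑[ x < m ] (w x * pascalConvolution n F (H x))
                           ≈ pascalConvolution n F (λ k → ∑[ x < m ] (w x * H x k))
  ∑-pascalConvolutionʳ ℕ.zero    {m} w F H =
    trans (sum-cong-≋ {m} (λ x → x∙yz≈y∙xz (w x) (F 0) (H x 0)))
          (sym (*-distribˡ-sum (F 0) (λ x → w x * H x 0)))
  ∑-pascalConvolutionʳ (ℕ.suc n) {m} w F H = begin
    ∑[ x < m ] (w x * (pascalConvolution n (F ∘ ℕ.suc) (H x) + pascalConvolution n F (H x ∘ ℕ.suc)))
      ≈⟨ sum-cong-≋ {m} (λ x → distribˡ (w x) _ _) ⟩
    ∑[ x < m ] (w x * pascalConvolution n (F ∘ ℕ.suc) (H x) + w x * pascalConvolution n F (H x ∘ ℕ.suc))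
      ≈⟨ ∑-distrib-+ {m} (λ x → w x * pascalConvolution n (F ∘ ℕ.suc) (H x))
                     (λ x → w x * pascalConvolution n F (H x ∘ ℕ.suc)) ⟩
    ∑[ x < m ] (w x * pascalConvolution n (F ∘ ℕ.suc) (H x))
      + ∑[ x < m ] (w x * pascalConvolution n F (H x ∘ ℕ.suc))
      ≈⟨ +-cong (∑-pascalConvolutionʳ n w _ H) (∑-pascalConvolutionʳ n w F _) ⟩
    pascalConvolution (ℕ.suc n) F (λ k → ∑[ x < m ] (w x * H x k)) ∎

  binomialTerm : ℕ → (ℕ → Carrier) → (ℕ → Carrier) → ℕ → Carrier
  binomialTerm n F G k = ℕ→R R (n C k) * (F k * G (n ∸ k))

  binomialConvolution : ℕ → (ℕ → Carrier) → (ℕ → Carrier) → Carrier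
  binomialConvolution n F G = ∑[ k ≤ n ] binomialTerm n F G (toℕ k)

  -- Pascal's rule splits every term but the first; the C(n,k+1)-parts, reindexed, form the convolution
  -- with G ∘ suc, whose top term vanishes as C(n,n+1) = 0.
  binomialConvolution-suc : ∀ n F G → binomialConvolution (ℕ.suc n) F G
                              ≈ binomialConvolution n (F ∘ ℕ.suc) G + binomialConvolution n F (G ∘ ℕ.suc)
  binomialConvolution-suc n F G = begin
    t₀ + ∑[ j ≤ n ] binomialTerm (ℕ.suc n) F G (ℕ.suc (toℕ j))
      ≈⟨ +-congˡ (sum-cong-≋ {ℕ.suc n} (pascal-rule ∘ toℕ)) ⟩
    t₀ + ∑[ j ≤ n ] (binomialTerm n (F ∘ ℕ.suc) G (toℕ j) + u (toℕ j))
      ≈⟨ +-congˡ (∑-distrib-+ {ℕ.suc n} (binomialTerm n (F ∘ ℕ.suc) G ∘ toℕ) (u ∘ toℕ)) ⟩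
    t₀ + (binomialConvolution n (F ∘ ℕ.suc) G + ∑[ j ≤ n ] u (toℕ j))
      ≈⟨ x+yz≈y+xz _ _ _ ⟩
    binomialConvolution n (F ∘ ℕ.suc) G + (t₀ + ∑[ j ≤ n ] u (toℕ j))
      ≈⟨ +-congˡ (+-congˡ shifted) ⟩
    binomialConvolution n (F ∘ ℕ.suc) G + binomialConvolution n F (G ∘ ℕ.suc) ∎
    where
    t₀ : Carrier
    t₀ = binomialTerm (ℕ.suc n) F G 0
    u : ℕ → Carrier
    u k = ℕ→R R (n C ℕ.suc k) * (F (ℕ.suc k) * G (n ∸ k))

    pascal-rule : ∀ k → binomialTerm (ℕ.suc n) F G (ℕ.suc k) ≈ binomialTerm n (F ∘ ℕ.suc) G k + u k
    pascal-rule k = trans (*-congʳ (trans (reflexive (≡.cong (ℕ→R R) (≡.sym (nCk+nC[k+1]≡[n+1]C[k+1] n k))))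
                                          (ℕ→R-homo-+ (n C k) (n C ℕ.suc k))))
                          (distribʳ _ _ _)

    u-last : u n ≈ 0#
    u-last = trans (*-congʳ (reflexive (≡.cong (ℕ→R R) (k>n⇒nCk≡0 (ℕₚ.n<1+n n))))) (zeroˡ _)

    shifted : ∑[ j ≤ n ] u (toℕ j) ≈ ∑[ j < n ] binomialTerm n F (G ∘ ℕ.suc) (ℕ.suc (toℕ j))
    shifted = begin
      ∑[ j ≤ n ] u (toℕ j)                        ≈⟨ sum-init-last {n} (u ∘ toℕ) ⟩
      ∑[ j < n ] u (toℕ (inject₁ j)) + u (toℕ (fromℕ n))
        ≈⟨ +-cong (sum-cong-≋ {n} (λ j → reflexive (≡.cong u (toℕ-inject₁ j))))
                  (trans (reflexive (≡.cong u (toℕ-fromℕ n))) u-last) ⟩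
      ∑[ j < n ] u (toℕ j) + 0#                   ≈⟨ +-identityʳ _ ⟩
      ∑[ j < n ] u (toℕ j)
        ≈⟨ sum-cong-≋ {n} (λ j → *-congˡ (*-congˡ (reflexive (≡.cong G (∸-toℕ-suc j))))) ⟩
      ∑[ j < n ] binomialTerm n F (G ∘ ℕ.suc) (ℕ.suc (toℕ j)) ∎

  pascalConvolution≈binomialConvolution : ∀ n F G → pascalConvolution n F G ≈ binomialConvolution n F G
  pascalConvolution≈binomialConvolution ℕ.zero F G = begin
    F 0 * G 0                 ≈⟨ *-identityˡ _ ⟨
    1# * (F 0 * G 0)          ≈⟨ *-congʳ (+-identityʳ 1#) ⟨
    (1# + 0#) * (F 0 * G 0)   ≈⟨ +-identityʳ _ ⟨
    binomialConvolution 0 F G ∎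
  pascalConvolution≈binomialConvolution (ℕ.suc n) F G =
    trans (+-cong (pascalConvolution≈binomialConvolution n _ G) (pascalConvolution≈binomialConvolution n F _))
          (sym (binomialConvolution-suc n F G))

  module _ (S : Species) where
    open Species S using (card)

    -- pOffset n e y is p_n(y) when the fibre over x already holds e x further points; p is the case e = 0.
    weight : ∀ {n m} → Vector ℕ m → Vector Carrier m → (Fin n → Fin m) → Carrier
    weight {n} {m} e y f =
      ΠF R m (λ x → ℕ→R R (card (e x ℕ.+ fibreSize f x))) * ΠF R n (λ i → y (f i))

    pOffset : (n : ℕ) → ∀ {m} → Vector ℕ m → Vector Carrier m → Carrier
    pOffset n {m} e y = ΣL R (allFuns n m) (weight e y)

    pOffset-cong : ∀ n {m} {e e′ : Vector ℕ m} (y : Vector Carrier m) → e ≗ e′ →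
                   pOffset n e y ≈ pOffset n e′ y
    pOffset-cong n {m} y e≗e′ = ΣL-cong (allFuns n m) λ f →
      *-congʳ (ΠF-cong m λ x →
        reflexive (≡.cong (λ k → ℕ→R R (card (k ℕ.+ fibreSize f x))) (e≗e′ x)))

    pOffset-zero : ∀ {m} (e : Vector ℕ m) (y : Vector Carrier m) →
                   pOffset 0 e y ≈ ΠF R m (λ x → ℕ→R R (card (e x)))
    pOffset-zero {m} e y = begin
      pOffset 0 e y                                       ≈⟨ +-identityʳ _ ⟩
      ΠF R m (λ x → ℕ→R R (card (e x ℕ.+ 0))) * 1#        ≈⟨ *-identityʳ _ ⟩
      ΠF R m (λ x → ℕ→R R (card (e x ℕ.+ 0)))
        ≈⟨ ΠF-cong m (λ x → reflexive (≡.cong (ℕ→R R ∘ card) (ℕₚ.+-identityʳ (e x)))) ⟩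
      ΠF R m (λ x → ℕ→R R (card (e x))) ∎

    weight-∷ : ∀ {n m} (e : Vector ℕ m) (y : Vector Carrier m) x (f : Fin n → Fin m) →
               weight e y (x ∷ f) ≈ y x * weight (updateAt e x ℕ.suc) y f
    weight-∷ {n} {m} e y x f = begin
      ΠF R m (λ z → ℕ→R R (card (e z ℕ.+ fibreSize (x ∷ f) z))) * (y x * ΠF R n (y ∘ f))
        ≈⟨ *-congʳ (ΠF-cong m (λ z → reflexive (≡.cong (ℕ→R R ∘ card) (+-fibreSize-∷ e x f z)))) ⟩
      ΠF R m (λ z → ℕ→R R (card (updateAt e x ℕ.suc z ℕ.+ fibreSize f z))) * (y x * ΠF R n (y ∘ f))
        ≈⟨ x∙yz≈y∙xz _ _ _ ⟩
      y x * weight (updateAt e x ℕ.suc) y f ∎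

    pOffset-suc : ∀ n {m} (e : Vector ℕ m) (y : Vector Carrier m) →
                  pOffset (ℕ.suc n) e y ≈ ∑[ x < m ] (y x * pOffset n (updateAt e x ℕ.suc) y)
    pOffset-suc n {m} e y = begin
      pOffset (ℕ.suc n) e y
        ≈⟨ ΣL-concatMap _ (allFin m) (weight e y) ⟩
      ΣL R (allFin m) (λ x → ΣL R (map (x ∷_) (allFuns n m)) (weight e y))
        ≈⟨ ΣL-cong (allFin m) (λ x → ΣL-map (x ∷_) (allFuns n m) (weight e y)) ⟩
      ΣL R (allFin m) (λ x → ΣL R (allFuns n m) (weight e y ∘ (x ∷_)))
        ≈⟨ ΣL-cong (allFin m) (λ x → ΣL-cong (allFuns n m) (weight-∷ e y x)) ⟩
      ΣL R (allFin m) (λ x → ΣL R (allFuns n m) (λ f → y x * weight (updateAt e x ℕ.suc) y f))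
        ≈⟨ ΣL-cong (allFin m) (λ x → sym (*-distribˡ-ΣL (y x) (allFuns n m) _)) ⟩
      ΣL R (allFin m) (λ x → y x * pOffset n (updateAt e x ℕ.suc) y)
        ≈⟨ ΣL-tabulate m (λ x → x) _ ⟩
      ∑[ x < m ] (y x * pOffset n (updateAt e x ℕ.suc) y) ∎

    pOffset-suc-singleton : ∀ n e₀ a →
                            pOffset (ℕ.suc n) (λ _ → e₀) (a ∷ []) ≈ a * pOffset n (λ _ → ℕ.suc e₀) (a ∷ [])
    pOffset-suc-singleton n e₀ a = begin
      pOffset (ℕ.suc n) (λ _ → e₀) (a ∷ [])
        ≈⟨ pOffset-suc n (λ _ → e₀) (a ∷ []) ⟩
      a * pOffset n (updateAt (λ _ → e₀) zero ℕ.suc) (a ∷ []) + 0#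
        ≈⟨ +-identityʳ _ ⟩
      a * pOffset n (updateAt (λ _ → e₀) zero ℕ.suc) (a ∷ [])
        ≈⟨ *-congˡ (pOffset-cong n (a ∷ []) bumped) ⟩
      a * pOffset n (λ _ → ℕ.suc e₀) (a ∷ []) ∎
      where
      bumped : updateAt (λ _ → e₀) zero ℕ.suc ≗ λ _ → ℕ.suc e₀
      bumped zero = ≡.refl

    pOffset-∷ : ∀ n {m} (e : Vector ℕ (ℕ.suc m)) a (y : Vector Carrier m) →
                pOffset n e (a ∷ y)
                  ≈ pascalConvolution n (λ k → pOffset k (λ _ → head e) (a ∷ []))
                                        (λ k → pOffset k (tail e) y)
    pOffset-∷ ℕ.zero {m} e a y = begin
      pOffset 0 e (a ∷ y)                                ≈⟨ pOffset-zero e (a ∷ y) ⟩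
      c₀ * ΠF R m (λ x → ℕ→R R (card (tail e x)))        ≈⟨ *-congʳ (*-identityʳ c₀) ⟨
      (c₀ * 1#) * ΠF R m (λ x → ℕ→R R (card (tail e x)))
        ≈⟨ *-cong (pOffset-zero (λ _ → head e) (a ∷ [])) (pOffset-zero (tail e) y) ⟨
      pOffset 0 (λ _ → head e) (a ∷ []) * pOffset 0 (tail e) y ∎
      where
      c₀ : Carrier
      c₀ = ℕ→R R (card (head e))
    pOffset-∷ (ℕ.suc n) {m} e a y = begin
      pOffset (ℕ.suc n) e (a ∷ y)
        ≈⟨ pOffset-suc n e (a ∷ y) ⟩
      a * pOffset n (updateAt e zero ℕ.suc) (a ∷ y)
        + ∑[ x < m ] (y x * pOffset n (updateAt e (suc x) ℕ.suc) (a ∷ y))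
        ≈⟨ +-cong (*-congˡ (pOffset-∷ n (updateAt e zero ℕ.suc) a y))
                  (sum-cong-≋ {m} (λ x → *-congˡ (pOffset-∷ n (updateAt e (suc x) ℕ.suc) a y))) ⟩
      a * pascalConvolution n F⁺ G + ∑[ x < m ] (y x * pascalConvolution n F (Gₓ x))
        ≈⟨ +-cong (*-distribˡ-pascalConvolution n a F⁺ G) (∑-pascalConvolutionʳ n y F Gₓ) ⟩
      pascalConvolution n (λ k → a * F⁺ k) G + pascalConvolution n F (λ k → ∑[ x < m ] (y x * Gₓ x k))
        ≈⟨ +-cong (pascalConvolution-cong n (λ k → sym (pOffset-suc-singleton k (head e) a)) (λ _ → refl))
                  (pascalConvolution-cong n (λ _ → refl) (λ k → sym (pOffset-suc k (tail e) y))) ⟩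
      pascalConvolution (ℕ.suc n) F G ∎
      where
      F F⁺ G : ℕ → Carrier
      F  k = pOffset k (λ _ → head e) (a ∷ [])
      F⁺ k = pOffset k (λ _ → ℕ.suc (head e)) (a ∷ [])
      G  k = pOffset k (tail e) y
      Gₓ : Fin m → ℕ → Carrier
      Gₓ x k = pOffset k (updateAt (tail e) x ℕ.suc) y

theorem2 : {c ℓ : Level} (R : CommutativeRing c ℓ) (S : Species) →
           let open CommutativeRing R in
           (a : Carrier) (m : ℕ) (y : Vector Carrier m) (n : ℕ) →
           p R S n (a ∷ y)
             ≈ ΣL R (upTo (Data.Nat.suc n)) (λ k →
                 ℕ→R R (n C k) * (p R S k (a ∷ []) * p R S (n ∸ k) y))
theorem2 R S a m y n = begin
  p R S n (a ∷ y)
    ≈⟨ pOffset-∷ R S n (λ _ → 0) a y ⟩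
  pascalConvolution R n (λ k → p R S k (a ∷ [])) (λ k → p R S k y)
    ≈⟨ pascalConvolution≈binomialConvolution R n _ _ ⟩
  binomialConvolution R n (λ k → p R S k (a ∷ [])) (λ k → p R S k y)
    ≈⟨ ΣL-applyUpTo R (λ k → k) (ℕ.suc n) _ ⟨
  ΣL R (upTo (ℕ.suc n)) (binomialTerm R n (λ k → p R S k (a ∷ [])) (λ k → p R S k y)) ∎
  where
  open CommutativeRing R using (setoid)
  open import Relation.Binary.Reasoning.Setoid setoid
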